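{- Let $T=(V,F)$ be a proper rooted tree with leaf set $R$ and $S=V\setminus R$, and let $F_1\subseteq F$ be such that every $u\in S$ has a child connected to $u$ by an edge of $F_1$. Then there exists a $T$-proper mapping $f:S\to R$ such that for every $u\in S$ the path $P_T(u,f(u))$ contains at least one edge of $F_1$.
   Context: A rooted tree is proper if every non-leaf node has at least $2$ children. $P_T(u,v)$ is the unique path in $T$ between $u$ and $v$. A mapping $f:S\to R$ is $T$-proper if $f(u)$ is a descendant of $u$ for every $u\in S$, and the paths $\{P_T(u,f(u)):u\in S\}$ are pairwise edge-disjoint. -}

module Defs where

open import Data.Nat using (ℕ; zero; suc; _≤_)
open import Data.List using (List; []; _∷_; _++_; length)
open import Data.Maybe using (Maybe; just; nothing)
open import Data.Product using (Σ; ∃; _×_; _,_)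
open import Data.Sum using (_⊎_)
open import Relation.Binary.PropositionalEquality using (_≡_; _≢_)
open import Relation.Nullary using (¬_)

data Tree : Set where
  node : List Tree → Tree

-- Nodes of a tree are addressed by paths from the root: the list of child
-- indices followed.  The root is [], the i-th child of u is u ++ (i ∷ []).
Pos : Set
Pos = List ℕ

mutual
  _at_ : Tree → Pos → Maybe Tree
  t at [] = just t
  node ts at (i ∷ p) = atList ts i p

  atList : List Tree → ℕ → Pos → Maybe Tree
  atList [] _ _ = nothing
  atList (t ∷ ts) zero p = t at p
  atList (t ∷ ts) (suc i) p = atList ts i p

IsNode : Tree → Pos → Set
IsNode T u = ∃ λ s → T at u ≡ just s

IsLeaf : Tree → Pos → Set
IsLeaf T u = T at u ≡ just (node [])

IsInternal : Tree → Pos → Set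
IsInternal T u = Σ Tree λ c → Σ (List Tree) λ cs → T at u ≡ just (node (c ∷ cs))

Proper : Tree → Set
Proper T = ∀ u ts → T at u ≡ just (node ts) → ts ≡ [] ⊎ 2 ≤ length ts

-- Edges: every non-root node v identifies the edge between v and its parent.
IsEdge : Tree → Pos → Set
IsEdge T e = IsNode T e × e ≢ []

ChildOf : Pos → Pos → Set
ChildOf v u = ∃ λ i → v ≡ u ++ (i ∷ [])

Descendant : Pos → Pos → Set
Descendant v u = ∃ λ w → u ++ w ≡ v

-- For v a descendant of u, the edge e (identified by its lower endpoint) lies
-- on the path P_T(u,v): e is a strict descendant of u and an ancestor-or-self of v.
OnPath : Pos → Pos → Pos → Set
OnPath u v e = (∃ λ i → ∃ λ w → u ++ (i ∷ w) ≡ e) × Descendant v e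

TProper : Tree → (Pos → Pos) → Set
TProper T f =
  (∀ u → IsInternal T u → IsLeaf T (f u) × Descendant (f u) u) ×
  (∀ u v → IsInternal T u → IsInternal T v → u ≢ v →
     ∀ e → ¬ (OnPath u (f u) e × OnPath v (f v) e))

module Submission where

open import Defs
open import Data.List using (List; []; _∷_; _++_; [_]; length)
open import Data.List.Properties using (++-assoc; ++-identityʳ; ++-cancelˡ; ∷-injective)
open import Data.Maybe using (just; fromMaybe; _>>=_)
open import Data.Nat using (ℕ; zero; suc; _∸_; _<_; s≤s)
open import Data.Nat.Properties using (m∸n≤m; <-≤-trans)
open import Data.Product using (∃; ∃₂; _×_; _,_; proj₁; proj₂)
open import Data.Sum using (_⊎_; inj₁; inj₂)
open import Relation.Binary.PropositionalEquality using (_≡_; _≢_; refl; sym; trans; cong; subst)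
open import Relation.Nullary using (¬_)

-- Each internal node u routes to a leaf by first taking its marked child c u
-- and from then on, at every node w, a child other than c w (possible since T
-- is proper). If the routes of u and v share an edge, one of u, v, say u, is a
-- strict ancestor of the other; then v lies on the route of u below its first
-- edge, where the route leaves v through a child other than c v, whereas the
-- route of v leaves v through c v.

mutual
  at-++ : ∀ t w p → t at (w ++ p) ≡ (t at w >>= _at p)
  at-++ t         []      p = refl
  at-++ (node ts) (i ∷ w) p = atList-++ ts i w p

  atList-++ : ∀ ts i w p → atList ts i (w ++ p) ≡ (atList ts i w >>= _at p)
  atList-++ []       i       w p = refl
  atList-++ (t ∷ ts) zero    w p = at-++ t w p
  atList-++ (t ∷ ts) (suc i) w p = atList-++ ts i w p

child-at : ∀ T w {ts} i → T at w ≡ just (node ts) → T at (w ++ [ i ]) ≡ atList ts i []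
child-at T w i eq = trans (at-++ T w [ i ]) (cong (_>>= _at [ i ]) eq)

ancestors-comparable : ∀ {x} u v → Descendant x u → Descendant x v →
  Descendant v u ⊎ Descendant u v
ancestors-comparable []      v       _             _             = inj₁ (v , refl)
ancestors-comparable (i ∷ u) []      _             _             = inj₂ (i ∷ u , refl)
ancestors-comparable (i ∷ u) (j ∷ v) (a , refl) (b , eq) with ∷-injective eq
... | refl , eq′ with ancestors-comparable u v (a , refl) (b , eq′)
...   | inj₁ (m , v≡) = inj₁ (m , cong (i ∷_) v≡)
...   | inj₂ (m , u≡) = inj₂ (m , cong (i ∷_) u≡)

onPath-inv : ∀ u i p e → OnPath u (u ++ i ∷ p) e → ∃₂ λ a b → e ≡ u ++ i ∷ a × a ++ b ≡ p
onPath-inv u i p e ((j , a , refl) , (b , eq))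
  with ∷-injective (++-cancelˡ u _ _ (trans (sym (++-assoc u (j ∷ a) b)) eq))
... | refl , a++b≡p = a , b , refl , a++b≡p

onPath⇒descendant : ∀ {u v e} → OnPath u v e → Descendant e u
onPath⇒descendant ((i , a , u++ia≡e) , _) = i ∷ a , u++ia≡e

choice-on-internal : ∀ T (P : Pos → ℕ → Set) → (∀ u → IsInternal T u → ∃ (P u)) →
  ∃ λ (c : Pos → ℕ) → ∀ u → IsInternal T u → P u (c u)
choice-on-internal T P h = (λ u → pick u (T at u) refl) , (λ u (_ , _ , p) → pick-spec u _ refl p)
  where
  pick : ∀ u m → T at u ≡ m → ℕ
  pick u (just (node (t ∷ ts))) eq = proj₁ (h u (t , ts , eq))
  pick u _                      _  = 0

  pick-spec : ∀ u m (eq : T at u ≡ m) {t ts} → m ≡ just (node (t ∷ ts)) → P u (pick u m eq)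
  pick-spec u _ eq refl = proj₂ (h u (_ , _ , eq))

module Walk (next : Pos → ℕ) where

  data Follows : Pos → List ℕ → Set where
    []   : ∀ {w} → Follows w []
    step : ∀ {w p} → Follows (w ++ [ next w ]) p → Follows w (next w ∷ p)

  follows-step : ∀ w a {x b} → Follows w (a ++ x ∷ b) → x ≡ next (w ++ a)
  follows-step w []      (step _) = cong next (sym (++-identityʳ w))
  follows-step w (_ ∷ a) (step f) = trans (follows-step (w ++ [ next w ]) a f)
                                         (cong next (++-assoc w [ next w ] a))

  mutual
    walk : Pos → Tree → List ℕ
    walk w (node [])       = []
    walk w (node (t ∷ ts)) = next w ∷ walkChild (w ++ [ next w ]) (next w) (t ∷ ts)

    -- The [] clause (index out of range) is junk, never reached when next is valid.
    walkChild : Pos → ℕ → List Tree → List ℕ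
    walkChild w k       []       = []
    walkChild w zero    (t ∷ ts) = walk w t
    walkChild w (suc k) (t ∷ ts) = walkChild w k ts

  mutual
    walk-follows : ∀ w s → Follows w (walk w s)
    walk-follows w (node [])       = []
    walk-follows w (node (t ∷ ts)) = step (walkChild-follows (w ++ [ next w ]) (next w) (t ∷ ts))

    walkChild-follows : ∀ w k ts → Follows w (walkChild w k ts)
    walkChild-follows w k       []       = []
    walkChild-follows w zero    (t ∷ ts) = walk-follows w t
    walkChild-follows w (suc k) (t ∷ ts) = walkChild-follows w k ts

  walkFrom : Tree → Pos → List ℕ
  walkFrom T w = walk w (fromMaybe (node []) (T at w))

  module _ (T : Tree)
    (next-valid : ∀ w t ts → T at w ≡ just (node (t ∷ ts)) → next w < length (t ∷ ts)) where

    mutual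
      walk-leaf : ∀ w s → T at w ≡ just s → IsLeaf T (w ++ walk w s)
      walk-leaf w (node []) eq = trans (cong (T at_) (++-identityʳ w)) eq
      walk-leaf w (node (t ∷ ts)) eq =
        trans (cong (T at_) (sym (++-assoc w [ next w ] _)))
              (walkChild-leaf (w ++ [ next w ]) (next w) (t ∷ ts)
                              (child-at T w (next w) eq) (next-valid w t ts eq))

      walkChild-leaf : ∀ w k ts → T at w ≡ atList ts k [] → k < length ts →
        IsLeaf T (w ++ walkChild w k ts)
      walkChild-leaf w zero    (t ∷ ts) eq _         = walk-leaf w t eq
      walkChild-leaf w (suc k) (t ∷ ts) eq (s≤s k<n) = walkChild-leaf w k ts eq k<n

    walkFrom-leaf : ∀ w → IsNode T w → IsLeaf T (w ++ walkFrom T w)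
    walkFrom-leaf w (s , eq) rewrite eq = walk-leaf w s eq

module Routes (c next : Pos → ℕ) (next≢c : ∀ w → next w ≢ c w) (rest : Pos → List ℕ)
  (rest-follows : ∀ u → Walk.Follows next (u ++ [ c u ]) (rest u)) where

  open Walk next using (Follows; follows-step)

  route : Pos → Pos
  route u = u ++ c u ∷ rest u

  first-edge-on-route : ∀ u → OnPath u (route u) (u ++ [ c u ])
  first-edge-on-route u = (c u , [] , refl) , rest u , ++-assoc u [ c u ] (rest u)

  route-leaves-below : ∀ u j m x {a a′ b} → a ++ b ≡ rest u →
    u ++ c u ∷ a ≡ (u ++ j ∷ m) ++ x ∷ a′ → x ≡ next (u ++ j ∷ m)
  route-leaves-below u j m x {a′ = a′} {b} a++b≡rest e≡
    with ∷-injective (++-cancelˡ u _ _ (trans e≡ (++-assoc u (j ∷ m) (x ∷ a′))))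
  ... | refl , refl = trans (follows-step (u ++ [ c u ]) m follows)
                            (cong next (++-assoc u [ c u ] m))
    where
    follows : Follows (u ++ [ c u ]) (m ++ x ∷ a′ ++ b)
    follows = subst (Follows _) (trans (sym a++b≡rest) (++-assoc m (x ∷ a′) b)) (rest-follows u)

  strictly-below-not-shared : ∀ u j m e →
    ¬ (OnPath u (route u) e × OnPath (u ++ j ∷ m) (route (u ++ j ∷ m)) e)
  strictly-below-not-shared u j m e (on-u , on-v)
    with onPath-inv u (c u) (rest u) e on-u | onPath-inv (u ++ j ∷ m) _ _ e on-v
  ... | a , b , refl , a++b≡rest | a′ , _ , e≡ , _ =
    next≢c v (sym (route-leaves-below u j m (c v) a++b≡rest e≡))
    where v = u ++ j ∷ m

  routes-edge-disjoint : ∀ u v → u ≢ v → ∀ e → ¬ (OnPath u (route u) e × OnPath v (route v) e)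
  routes-edge-disjoint u v u≢v e (on-u , on-v)
    with ancestors-comparable u v (onPath⇒descendant on-u) (onPath⇒descendant on-v)
  ... | inj₁ ([]    , u≡v) = u≢v (trans (sym (++-identityʳ u)) u≡v)
  ... | inj₁ (j ∷ m , refl) = strictly-below-not-shared u j m e (on-u , on-v)
  ... | inj₂ ([]    , v≡u) = u≢v (sym (trans (sym (++-identityʳ v)) v≡u))
  ... | inj₂ (j ∷ m , refl) = strictly-below-not-shared v j m e (on-v , on-u)

1∸n≢n : ∀ n → 1 ∸ n ≢ n
1∸n≢n zero          ()
1∸n≢n (suc zero)    ()
1∸n≢n (suc (suc n)) ()

lemma12 : (T : Tree) → Proper T →
    (F₁ : Pos → Set) → (∀ e → F₁ e → IsEdge T e) →
    (∀ u → IsInternal T u → ∃ λ v → ChildOf v u × IsNode T v × F₁ v) →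
    ∃ λ (f : Pos → Pos) → TProper T f ×
    (∀ u → IsInternal T u → ∃ λ e → OnPath u (f u) e × F₁ e)
lemma12 T proper F₁ _ marked
  with choice-on-internal T (λ u i → IsNode T (u ++ [ i ]) × F₁ (u ++ [ i ])) marked-index
  where
  marked-index : ∀ u → IsInternal T u → ∃ λ i → IsNode T (u ++ [ i ]) × F₁ (u ++ [ i ])
  marked-index u int with marked u int
  ... | _ , (i , refl) , child , f₁ = i , child , f₁
... | c , c-spec =
  route ,
  ((λ u int → route-leaf u int , (c u ∷ rest u , refl)) , λ u v _ _ → routes-edge-disjoint u v) ,
  λ u int → u ++ [ c u ] , first-edge-on-route u , proj₂ (c-spec u int)
  where
  -- 1 ∸ c w is a child index other than c w; it exists because T is proper.
  next : Pos → ℕ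
  next w = 1 ∸ c w

  next-valid : ∀ w t ts → T at w ≡ just (node (t ∷ ts)) → next w < length (t ∷ ts)
  next-valid w t ts eq with proper w (t ∷ ts) eq
  ... | inj₂ 2≤n = <-≤-trans (s≤s (m∸n≤m 1 (c w))) 2≤n

  open Walk next using (walk-follows; walkFrom; walkFrom-leaf)

  rest : Pos → List ℕ
  rest u = walkFrom T (u ++ [ c u ])

  open Routes c next (λ w → 1∸n≢n (c w)) rest (λ u → walk-follows _ _)

  route-leaf : ∀ u → IsInternal T u → IsLeaf T (route u)
  route-leaf u int = subst (IsLeaf T) (++-assoc u [ c u ] (rest u))
                           (walkFrom-leaf T next-valid (u ++ [ c u ]) (proj₁ (c-spec u int)))
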